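{- For every integer $i\ge 0$, let $T_i$ be the complete binary tree with $2^i$ leaves. Every rectangular layout of $T_i$ on the integer grid has width at least $\lfloor i/2\rfloor$ and height at least $\lfloor i/2\rfloor$.
   Context: A (strong) rectangular layout of a graph is a set of axis-parallel rectangles with pairwise disjoint interiors, one per vertex, such that two rectangles' boundaries share a segment of positive length if and only if the corresponding vertices are adjacent. On the integer grid all corners have integer coordinates; width and height are those of the smallest enclosing axis-parallel bounding box. -}

module Defs where

open import Data.Nat using (ℕ; zero; suc)
open import Data.Integer using (ℤ; _≤_; _<_; _⊓_; _⊔_; _-_)
open import Data.List using (List; []; _∷_; map; _++_; foldr)
open import Data.Product using (_×_)
open import Data.Sum using (_⊎_)
open import Relation.Binary.PropositionalEquality using (_≡_; _≢_)

-- The complete binary tree T_i with 2^i leaves.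
-- A vertex of T_i is either the root, or a vertex of the left copy of
-- T_{i-1}, or a vertex of the right copy of T_{i-1}.

data Node : ℕ → Set where
  root  : ∀ {i} → Node i
  left  : ∀ {i} → Node i → Node (suc i)
  right : ∀ {i} → Node i → Node (suc i)

data Edge : ∀ {i} → Node i → Node i → Set where
  root-left  : ∀ {i} → Edge {suc i} root (left root)
  root-right : ∀ {i} → Edge {suc i} root (right root)
  in-left    : ∀ {i} {u v : Node i} → Edge u v → Edge (left u) (left v)
  in-right   : ∀ {i} {u v : Node i} → Edge u v → Edge (right u) (right v)

Adj : ∀ {i} → Node i → Node i → Set
Adj u v = Edge u v ⊎ Edge v u

allNodes : (i : ℕ) → List (Node i)
allNodes zero    = root ∷ []
allNodes (suc i) = root ∷ (map left (allNodes i) ++ map right (allNodes i))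

record Rect : Set where
  field
    x₁ x₂ y₁ y₂ : ℤ
    x₁<x₂ : x₁ < x₂
    y₁<y₂ : y₁ < y₂
open Rect public

InteriorsDisjoint : Rect → Rect → Set
InteriorsDisjoint R S =
  x₂ R ≤ x₁ S ⊎ x₂ S ≤ x₁ R ⊎ y₂ R ≤ y₁ S ⊎ y₂ S ≤ y₁ R

-- The boundaries of R and S share a segment of positive length
-- (for rectangles with disjoint interiors): either a vertical side of one
-- lies on the same line as the opposite vertical side of the other and
-- their y-ranges overlap in an interval of positive length, or the same
-- with the roles of x and y exchanged.
ShareSegment : Rect → Rect → Set
ShareSegment R S =
    ((x₂ R ≡ x₁ S ⊎ x₂ S ≡ x₁ R) × (y₁ R < y₂ S × y₁ S < y₂ R))
  ⊎ ((y₂ R ≡ y₁ S ⊎ y₂ S ≡ y₁ R) × (x₁ R < x₂ S × x₁ S < x₂ R))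

record Layout (i : ℕ) : Set where
  field
    rect     : Node i → Rect
    disjoint : ∀ (u v : Node i) → u ≢ v →
               InteriorsDisjoint (rect u) (rect v)
    adj⇒share : ∀ (u v : Node i) → u ≢ v →
               Adj u v → ShareSegment (rect u) (rect v)
    share⇒adj : ∀ (u v : Node i) → u ≢ v →
               ShareSegment (rect u) (rect v) → Adj u v
open Layout public

minX maxX minY maxY : ∀ {i} → Layout i → ℤ
minX {i} L = foldr _⊓_ (x₁ (rect L root)) (map (λ u → x₁ (rect L u)) (allNodes i))
maxX {i} L = foldr _⊔_ (x₂ (rect L root)) (map (λ u → x₂ (rect L u)) (allNodes i))
minY {i} L = foldr _⊓_ (y₁ (rect L root)) (map (λ u → y₁ (rect L u)) (allNodes i))
maxY {i} L = foldr _⊔_ (y₂ (rect L root)) (map (λ u → y₂ (rect L u)) (allNodes i))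

width height : ∀ {i} → Layout i → ℤ
width  L = maxX L - minX L
height L = maxY L - minY L

{-# OPTIONS --safe #-}
module Submission where

open import Defs
open import Data.Nat using (ℕ; _/_; zero; suc; s≤s; z≤n; ⌊_/2⌋)
open import Data.Integer using (+_; _≤_; ℤ; _<_; _⊓_; _⊔_; _+_; _-_; -_; 1ℤ; _<?_; +≤+) renaming (suc to sucℤ)
open import Data.Product using (_×_; ∃-syntax; _,_)

open import Algebra.Properties.AbelianGroup using (xyx⁻¹≈y)
open import Data.Empty using (⊥-elim)
open import Data.Integer.Properties
  using (≤-refl; ≤-trans; ≤-total; <⇒≤; ≤-<-trans; ≤⇒≯; ≮⇒≥; i<j⇒suc[i]≤j;
         +-assoc; +-comm; +-identityʳ; +-monoˡ-≤; +-0-abelianGroup;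
         i≤j⇒i⊓k≤j; i≤j⇒k⊓i≤j; i≤j⇒i≤j⊔k; i≤j⇒i≤k⊔j; module ≤-Reasoning)
open import Data.List using (map; foldr)
open import Data.List.Membership.Propositional using (_∈_)
open import Data.List.Membership.Propositional.Properties using (∈-map⁺; ∈-++⁺ˡ; ∈-++⁺ʳ)
open import Data.List.Properties using (foldr-preservesᵒ)
import Data.List.Relation.Unary.Any as Any
open import Data.List.Relation.Unary.Any.Properties using (map⁺)
open import Data.Nat.DivMod using (m/n≡1+[m∸n]/n)
import Data.Nat.Properties as ℕ
open import Data.Sum using (_⊎_; inj₁; inj₂; [_,_]′; swap)
open import Function using (_∘_)
open import Function.Definitions using (Injective)
open import Relation.Binary.Definitions using (Symmetric)
open import Relation.Binary.PropositionalEquality using (_≡_; _≢_; refl; trans; cong)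
open import Relation.Nullary using (yes; no)

-- Call k rectangles a chain on row y (the unit strip [y, y + 1]) if all of them cover the row
-- and each lies to the left of the next; a chain of length k inside the bounding box forces
-- width ≥ k, and transposing the layout gives the height.  Every layout of T_h has a chain of
-- length ⌊h/2⌋ + 1, by induction: T_{h+2} contains three disjoint copies A, B, C of T_h, and
-- the row of one of them, say B, lies between the rows of the other two.  The tree path from
-- A to C avoids B, and consecutive rectangles along it share a boundary segment, so their
-- y-ranges overlap or touch and some rectangle on the path covers B's row.  Being
-- interior-disjoint from the rectangles of B's chain, it is horizontally separated from all of
-- them and extends that chain by one.

CoversRow : ℤ → Rect → Set
CoversRow y R = y₁ R ≤ y × y < y₂ R

XSeparated : Rect → Rect → Set
XSeparated R S = x₂ R ≤ x₁ S ⊎ x₂ S ≤ x₁ R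

shareSegment-y₁≤y₂ : ∀ R S → ShareSegment R S → y₁ S ≤ y₂ R
shareSegment-y₁≤y₂ _ _ (inj₁ (_ , _ , S<R))   = <⇒≤ S<R
shareSegment-y₁≤y₂ _ _ (inj₂ (inj₁ refl , _)) = ≤-refl
shareSegment-y₁≤y₂ R S (inj₂ (inj₂ S₂≡R₁ , _)) = begin
  y₁ S ≤⟨ <⇒≤ (y₁<y₂ S) ⟩
  y₂ S ≡⟨ S₂≡R₁ ⟩
  y₁ R ≤⟨ <⇒≤ (y₁<y₂ R) ⟩
  y₂ R ∎
  where open ≤-Reasoning

shareSegment-sym : ∀ R S → ShareSegment R S → ShareSegment S R
shareSegment-sym _ _ (inj₁ (touch , R<S , S<R)) = inj₁ (swap touch , S<R , R<S)
shareSegment-sym _ _ (inj₂ (touch , R<S , S<R)) = inj₂ (swap touch , S<R , R<S)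

interiorsDisjoint⇒xSeparated : ∀ R S {y} → InteriorsDisjoint R S →
  CoversRow y R → CoversRow y S → XSeparated R S
interiorsDisjoint⇒xSeparated _ _ (inj₁ R≤S)               _          _          = inj₁ R≤S
interiorsDisjoint⇒xSeparated _ _ (inj₂ (inj₁ S≤R))        _          _          = inj₂ S≤R
interiorsDisjoint⇒xSeparated _ _ (inj₂ (inj₂ (inj₁ R≤S))) (_ , y<R₂) (S₁≤y , _) =
  ⊥-elim (≤⇒≯ R≤S (≤-<-trans S₁≤y y<R₂))
interiorsDisjoint⇒xSeparated _ _ (inj₂ (inj₂ (inj₂ S≤R))) (R₁≤y , _) (_ , y<S₂) =
  ⊥-elim (≤⇒≯ S≤R (≤-<-trans R₁≤y y<S₂))

transpose : Rect → Rect
transpose R = record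
  { x₁ = y₁ R ; x₂ = y₂ R ; y₁ = x₁ R ; y₂ = x₂ R ; x₁<x₂ = y₁<y₂ R ; y₁<y₂ = x₁<x₂ R }

interiorsDisjoint-transpose : ∀ R S → InteriorsDisjoint R S →
  InteriorsDisjoint (transpose R) (transpose S)
interiorsDisjoint-transpose _ _ (inj₁ d)               = inj₂ (inj₂ (inj₁ d))
interiorsDisjoint-transpose _ _ (inj₂ (inj₁ d))        = inj₂ (inj₂ (inj₂ d))
interiorsDisjoint-transpose _ _ (inj₂ (inj₂ (inj₁ d))) = inj₁ d
interiorsDisjoint-transpose _ _ (inj₂ (inj₂ (inj₂ d))) = inj₂ (inj₁ d)

DisjointInteriors : {V : Set} → (V → Rect) → Set
DisjointInteriors f = ∀ u v → u ≢ v → InteriorsDisjoint (f u) (f v)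

SharesAlong : {V : Set} → (V → V → Set) → (V → Rect) → Set
SharesAlong _~_ f = ∀ {u v} → u ~ v → ShareSegment (f u) (f v)

OutsideImage : {V W : Set} → (W → V) → V → Set
OutsideImage e v = ∀ w → v ≢ e w

sharesAlong-symmetrise : ∀ {V : Set} {_~_ : V → V → Set} (f : V → Rect) → SharesAlong _~_ f →
  SharesAlong (λ u v → u ~ v ⊎ v ~ u) f
sharesAlong-symmetrise f shares (inj₁ u~v) = shares u~v
sharesAlong-symmetrise f shares {u} {v} (inj₂ v~u) = shareSegment-sym (f v) (f u) (shares v~u)

disjointInteriors-∘ : ∀ {V W : Set} (f : V → Rect) (e : W → V) →
  Injective _≡_ _≡_ e → DisjointInteriors f → DisjointInteriors (f ∘ e)
disjointInteriors-∘ f e injective disjoint u v u≢v = disjoint (e u) (e v) (u≢v ∘ injective)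

module _ {V : Set} (_~_ : V → V → Set) (Q : V → Set) where

  infixr 5 _∷⟨_⟩_

  data Walk : V → V → Set where
    [_]    : ∀ {u} → Q u → Walk u u
    _∷⟨_⟩_ : ∀ {u v w} → Q u → u ~ v → Walk v w → Walk u w

module _ {V : Set} {_~_ : V → V → Set} {Q : V → Set} where

  infixr 5 _++_

  head : ∀ {u w} → Walk _~_ Q u w → Q u
  head [ q ]          = q
  head (q ∷⟨ _ ⟩ _)   = q

  _++_ : ∀ {u v w} → Walk _~_ Q u v → Walk _~_ Q v w → Walk _~_ Q u w
  [ _ ]            ++ walk′ = walk′
  (q ∷⟨ a ⟩ walk)  ++ walk′ = q ∷⟨ a ⟩ (walk ++ walk′)

  reverse : Symmetric _~_ → ∀ {u w} → Walk _~_ Q u w → Walk _~_ Q w u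
  reverse sym [ q ]             = [ q ]
  reverse sym (q ∷⟨ a ⟩ walk)   = reverse sym walk ++ (head walk ∷⟨ sym a ⟩ [ q ])

Between : ℤ → ℤ → ℤ → Set
Between x y z = (x ≤ y × y ≤ z) ⊎ (z ≤ y × y ≤ x)

one-lies-between : ∀ a b c → Between b a c ⊎ Between a b c ⊎ Between a c b
one-lies-between a b c with ≤-total a b | ≤-total b c | ≤-total a c
... | inj₁ a≤b | inj₁ b≤c | _        = inj₂ (inj₁ (inj₁ (a≤b , b≤c)))
... | inj₁ a≤b | inj₂ c≤b | inj₁ a≤c = inj₂ (inj₂ (inj₁ (a≤c , c≤b)))
... | inj₁ a≤b | inj₂ c≤b | inj₂ c≤a = inj₁ (inj₂ (c≤a , a≤b))
... | inj₂ b≤a | _        | inj₁ a≤c = inj₁ (inj₁ (b≤a , a≤c))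
... | inj₂ b≤a | inj₁ b≤c | inj₂ c≤a = inj₂ (inj₂ (inj₂ (b≤c , c≤a)))
... | inj₂ b≤a | inj₂ c≤b | inj₂ _   = inj₂ (inj₁ (inj₂ (c≤b , b≤a)))

module _ {V : Set} {_~_ : V → V → Set} (f : V → Rect) (shares : SharesAlong _~_ f) where

  walk-covers-row : ∀ {Q u w y} → Walk _~_ Q u w → y₁ (f u) ≤ y → y < y₂ (f w) →
    ∃[ p ] Q p × CoversRow y (f p)
  walk-covers-row {u = u} [ q ] u₁≤y y<w₂ = u , q , u₁≤y , y<w₂
  walk-covers-row {u = u} {y = y} (q ∷⟨ u~v ⟩ walk) u₁≤y y<w₂ with y <? y₂ (f u)
  ... | yes y<u₂ = u , q , u₁≤y , y<u₂
  ... | no  y≮u₂ =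
    walk-covers-row walk (≤-trans (shareSegment-y₁≤y₂ (f u) (f _) (shares u~v)) (≮⇒≥ y≮u₂)) y<w₂

  walk-covers-between : Symmetric _~_ → ∀ {Q u w a b y} → Walk _~_ Q u w →
    CoversRow a (f u) → CoversRow b (f w) → Between a y b → ∃[ p ] Q p × CoversRow y (f p)
  walk-covers-between _ walk (u₁≤a , _) (_ , b<w₂) (inj₁ (a≤y , y≤b)) =
    walk-covers-row walk (≤-trans u₁≤a a≤y) (≤-<-trans y≤b b<w₂)
  walk-covers-between sym walk (_ , a<u₂) (w₁≤b , _) (inj₂ (b≤y , y≤a)) =
    walk-covers-row (reverse sym walk) (≤-trans w₁≤b b≤y) (≤-<-trans y≤a a<u₂)

data RowChain {V : Set} (f : V → Rect) (y : ℤ) : ℤ → ℕ → Set where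
  []   : ∀ {lo} → RowChain f y lo zero
  cons : ∀ {lo k} (u : V) → lo ≤ x₁ (f u) → CoversRow y (f u) →
         RowChain f y (x₂ (f u)) k → RowChain f y lo (suc k)

rowChain-map : ∀ {V W : Set} {f : V → Rect} {y lo k} (e : W → V) →
  RowChain (f ∘ e) y lo k → RowChain f y lo k
rowChain-map e []                        = []
rowChain-map e (cons w lo≤w covers rest) = cons (e w) lo≤w covers (rowChain-map e rest)

rowChain-insert : ∀ {V W : Set} {f : V → Rect} {y lo k} (e : W → V) {p : V} →
  (∀ w → CoversRow y (f (e w)) → XSeparated (f p) (f (e w))) →
  lo ≤ x₁ (f p) → CoversRow y (f p) → RowChain (f ∘ e) y lo k → RowChain f y lo (suc k)
rowChain-insert e {p} separated lo≤p covers [] = cons p lo≤p covers []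
rowChain-insert e {p} separated lo≤p covers (cons w lo≤w coversʷ rest)
  with separated w coversʷ
... | inj₁ p≤w = cons p lo≤p covers (rowChain-map e (cons w p≤w coversʷ rest))
... | inj₂ w≤p = cons (e w) lo≤w coversʷ (rowChain-insert e separated w≤p covers rest)

rowChain-length : ∀ {V : Set} {f : V → Rect} {y lo k b} → RowChain f y lo k →
  (∀ u → x₂ (f u) ≤ b) → lo ≤ b → lo + + k ≤ b
rowChain-length {lo = lo} {b = b} [] _ lo≤b = begin
  lo + + 0 ≡⟨ +-identityʳ lo ⟩
  lo       ≤⟨ lo≤b ⟩
  b        ∎
  where open ≤-Reasoning
rowChain-length {f = f} {lo = lo} {k = suc k} {b = b} (cons u lo≤u _ rest) upper _ = begin
  lo + + suc k       ≡⟨ +-assoc lo 1ℤ (+ k) ⟨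
  lo + 1ℤ + + k      ≡⟨ cong (_+ + k) (+-comm lo 1ℤ) ⟩
  sucℤ lo + + k      ≤⟨ +-monoˡ-≤ (+ k) (i<j⇒suc[i]≤j (≤-<-trans lo≤u (x₁<x₂ (f u)))) ⟩
  x₂ (f u) + + k     ≤⟨ rowChain-length rest upper (upper u) ⟩
  b                  ∎
  where open ≤-Reasoning

module ChainExtension {V : Set} {_~_ : V → V → Set} (f : V → Rect)
       (disjoint : DisjointInteriors f) (shares : SharesAlong _~_ f) (sym : Symmetric _~_)
       {a : ℤ} (lower : ∀ v → a ≤ x₁ (f v)) where

  rowChain-extend : ∀ {W : Set} {eX eY eZ : W → V} →
    (∀ u v → Walk _~_ (OutsideImage eZ) (eX u) (eY v)) →
    ∀ {ρX ρY ρZ k m n} → RowChain (f ∘ eX) ρX a (suc m) → RowChain (f ∘ eY) ρY a (suc n) →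
    RowChain (f ∘ eZ) ρZ a k → Between ρX ρZ ρY → RowChain f ρZ a (suc k)
  rowChain-extend {eZ = eZ} walks (cons x _ coversˣ _) (cons y _ coversʸ _) chainZ between
    with walk-covers-between f shares sym (walks x y) coversˣ coversʸ between
  ... | p , p∉Z , coversᵖ =
    rowChain-insert eZ
      (λ w coversʷ → interiorsDisjoint⇒xSeparated (f p) (f (eZ w))
                       (disjoint p (eZ w) (p∉Z w)) coversᵖ coversʷ)
      (lower p) coversᵖ chainZ

Adj-sym : ∀ {i} → Symmetric (Adj {i})
Adj-sym = swap

PreservesEdges : ∀ {h H} → (Node h → Node H) → Set
PreservesEdges e = ∀ {u v} → Edge u v → Edge (e u) (e v)

ascend : ∀ {h H} {Q : Node H → Set} (e : Node h → Node H) → PreservesEdges e →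
  (∀ u → Q (e u)) → ∀ u → Walk Adj Q (e u) (e root)
ascend e edge q root      = [ q root ]
ascend e edge q (left u)  =
  ascend (e ∘ left) (edge ∘ in-left) (q ∘ left) u ++ q (left root) ∷⟨ inj₂ (edge root-left) ⟩ [ q root ]
ascend e edge q (right u) =
  ascend (e ∘ right) (edge ∘ in-right) (q ∘ right) u ++ q (right root) ∷⟨ inj₂ (edge root-right) ⟩ [ q root ]

ll lr rl : ∀ {h} → Node h → Node (suc (suc h))
ll u = left (left u)
lr u = left (right u)
rl u = right (left u)

module _ {h : ℕ} where

  ll⇝lr : (u v : Node h) → Walk Adj (OutsideImage rl) (ll u) (lr v)
  ll⇝lr u v =
       ascend ll (in-left ∘ in-left) (λ _ _ ()) u
    ++ (λ _ ()) ∷⟨ inj₂ (in-left root-left) ⟩ (λ _ ()) ∷⟨ inj₁ (in-left root-right) ⟩ [ (λ _ ()) ]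
    ++ reverse Adj-sym (ascend lr (in-left ∘ in-right) (λ _ _ ()) v)

  ll⇝rl : (u v : Node h) → Walk Adj (OutsideImage lr) (ll u) (rl v)
  ll⇝rl u v =
       ascend ll (in-left ∘ in-left) (λ _ _ ()) u
    ++ (λ _ ()) ∷⟨ inj₂ (in-left root-left) ⟩ (λ _ ()) ∷⟨ inj₂ root-left ⟩
       (λ _ ()) ∷⟨ inj₁ root-right ⟩ (λ _ ()) ∷⟨ inj₁ (in-right root-left) ⟩ [ (λ _ ()) ]
    ++ reverse Adj-sym (ascend rl (in-right ∘ in-left) (λ _ _ ()) v)

  lr⇝rl : (u v : Node h) → Walk Adj (OutsideImage ll) (lr u) (rl v)
  lr⇝rl u v =
       ascend lr (in-left ∘ in-right) (λ _ _ ()) u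
    ++ (λ _ ()) ∷⟨ inj₂ (in-left root-right) ⟩ (λ _ ()) ∷⟨ inj₂ root-left ⟩
       (λ _ ()) ∷⟨ inj₁ root-right ⟩ (λ _ ()) ∷⟨ inj₁ (in-right root-left) ⟩ [ (λ _ ()) ]
    ++ reverse Adj-sym (ascend rl (in-right ∘ in-left) (λ _ _ ()) v)

rowChain-singleton : ∀ {V : Set} (f : V → Rect) {a} (u : V) → a ≤ x₁ (f u) →
  ∃[ y ] RowChain f y a 1
rowChain-singleton f u a≤u = y₁ (f u) , cons u a≤u (≤-refl , y₁<y₂ (f u)) []

rowChain-tree : ∀ h (f : Node h → Rect) → DisjointInteriors f → SharesAlong Edge f →
  ∀ {a} → (∀ u → a ≤ x₁ (f u)) → ∃[ y ] RowChain f y a (suc ⌊ h /2⌋)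
rowChain-tree zero          f _ _ lower = rowChain-singleton f root (lower root)
rowChain-tree (suc zero)    f _ _ lower = rowChain-singleton f root (lower root)
rowChain-tree (suc (suc h)) f disjoint shares {a} lower =
  combine (copy ll (λ { refl → refl }) (in-left ∘ in-left))
          (copy lr (λ { refl → refl }) (in-left ∘ in-right))
          (copy rl (λ { refl → refl }) (in-right ∘ in-left))
  where
  Chain : (Node h → Node (suc (suc h))) → Set
  Chain e = ∃[ y ] RowChain (f ∘ e) y a (suc ⌊ h /2⌋)

  copy : (e : Node h → Node (suc (suc h))) → Injective _≡_ _≡_ e → PreservesEdges e → Chain e
  copy e injective edge =
    rowChain-tree h (f ∘ e) (disjointInteriors-∘ f e injective disjoint) (shares ∘ edge) (lower ∘ e)

  open ChainExtension f disjoint (sharesAlong-symmetrise f shares) Adj-sym lower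

  combine : Chain ll → Chain lr → Chain rl → ∃[ y ] RowChain f y a (suc (suc ⌊ h /2⌋))
  combine (ρA , chainA) (ρB , chainB) (ρC , chainC) with one-lies-between ρA ρB ρC
  ... | inj₁ A-between        = ρA , rowChain-extend lr⇝rl chainB chainC chainA A-between
  ... | inj₂ (inj₁ B-between) = ρB , rowChain-extend ll⇝rl chainA chainC chainB B-between
  ... | inj₂ (inj₂ C-between) = ρC , rowChain-extend ll⇝lr chainA chainB chainC C-between

width-tree : ∀ h (f : Node h → Rect) → DisjointInteriors f → SharesAlong Edge f → ∀ {a b} →
  (∀ u → a ≤ x₁ (f u)) → (∀ u → x₂ (f u) ≤ b) → + suc ⌊ h /2⌋ ≤ b - a
width-tree h f disjoint shares {a} {b} lower upper with rowChain-tree h f disjoint shares lower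
... | _ , chain = begin
  + suc ⌊ h /2⌋           ≡⟨ xyx⁻¹≈y +-0-abelianGroup a _ ⟨
  a + + suc ⌊ h /2⌋ - a   ≤⟨ +-monoˡ-≤ (- a) (rowChain-length chain upper a≤b) ⟩
  b - a                   ∎
  where
  open ≤-Reasoning
  a≤b : a ≤ b
  a≤b = ≤-trans (lower root) (≤-trans (<⇒≤ (x₁<x₂ (f root))) (upper root))

n/2≡⌊n/2⌋ : ∀ n → n / 2 ≡ ⌊ n /2⌋
n/2≡⌊n/2⌋ zero          = refl
n/2≡⌊n/2⌋ (suc zero)    = refl
n/2≡⌊n/2⌋ (suc (suc n)) =
  trans (m/n≡1+[m∸n]/n {suc (suc n)} {2} (s≤s (s≤s z≤n))) (cong suc (n/2≡⌊n/2⌋ n))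

edge⇒≢ : ∀ {i} {u v : Node i} → Edge u v → u ≢ v
edge⇒≢ root-left      ()
edge⇒≢ root-right     ()
edge⇒≢ (in-left  uv) refl = edge⇒≢ uv refl
edge⇒≢ (in-right uv) refl = edge⇒≢ uv refl

∈-allNodes : ∀ i (u : Node i) → u ∈ allNodes i
∈-allNodes zero    root      = Any.here refl
∈-allNodes (suc i) root      = Any.here refl
∈-allNodes (suc i) (left u)  = Any.there (∈-++⁺ˡ (∈-map⁺ left (∈-allNodes i u)))
∈-allNodes (suc i) (right u) = Any.there (∈-++⁺ʳ (map left (allNodes i)) (∈-map⁺ right (∈-allNodes i u)))

foldr-⊓-≤ : ∀ {A : Set} (g : A → ℤ) c {x xs} → x ∈ xs → foldr _⊓_ c (map g xs) ≤ g x
foldr-⊓-≤ g c {x} {xs} x∈xs =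
  foldr-preservesᵒ {P = _≤ g x} (λ i j → [ i≤j⇒i⊓k≤j j , i≤j⇒k⊓i≤j i ]′) c (map g xs)
    (inj₂ (map⁺ (Any.map (λ { refl → ≤-refl }) x∈xs)))

foldr-⊔-≥ : ∀ {A : Set} (g : A → ℤ) c {x xs} → x ∈ xs → g x ≤ foldr _⊔_ c (map g xs)
foldr-⊔-≥ g c {x} {xs} x∈xs =
  foldr-preservesᵒ {P = g x ≤_} (λ i j → [ i≤j⇒i≤j⊔k j , i≤j⇒i≤k⊔j i ]′) c (map g xs)
    (inj₂ (map⁺ (Any.map (λ { refl → ≤-refl }) x∈xs)))

lemma12 : (i : ℕ) (L : Layout i) →
    (+ (i / 2) ≤ width L) × (+ (i / 2) ≤ height L)
lemma12 i L =
  bounding-box-width f (disjoint L) shares ,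
  bounding-box-width (transpose ∘ f)
    (λ u v → interiorsDisjoint-transpose (f u) (f v) ∘ disjoint L u v) (swap ∘ shares)
  where
  f : Node i → Rect
  f = rect L
  shares : SharesAlong Edge f
  shares uv = adj⇒share L _ _ (edge⇒≢ uv) (inj₁ uv)
  bounding-box-width : (g : Node i → Rect) → DisjointInteriors g → SharesAlong Edge g →
    + (i / 2) ≤ foldr _⊔_ (x₂ (g root)) (map (x₂ ∘ g) (allNodes i))
              - foldr _⊓_ (x₁ (g root)) (map (x₁ ∘ g) (allNodes i))
  bounding-box-width g disjointᵍ sharesᵍ =
    ≤-trans (+≤+ (ℕ.m≤n⇒m≤1+n (ℕ.≤-reflexive (n/2≡⌊n/2⌋ i))))
            (width-tree i g disjointᵍ sharesᵍ (λ u → foldr-⊓-≤ (x₁ ∘ g) _ (∈-allNodes i u))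
                                              (λ u → foldr-⊔-≥ (x₂ ∘ g) _ (∈-allNodes i u)))
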